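{- For every $n\ge1$ there is a bijection $\phi_F:\mathcal{FL}^{(B)}_n\cup\mathcal{FL}^{(D)}_n\to\mathcal{T}^\circ_n\cup\mathcal{T}^*_n$ which, for each $1\le k\le n$, restricts to a bijection from $\mathcal{FL}^{(B)}_{n,k}$ onto $\mathcal{T}^\circ_{n,k}$ and to a bijection from $\mathcal{FL}^{(D)}_{n,k}$ onto $\mathcal{T}^*_{n,k}$.
   Context: Signed permutations of $[n]$ in window notation $\sigma=\sigma_1\cdots\sigma_n$ (entries in $\{\pm1,\dots,\pm n\}$, absolute values a permutation of $[n]$). For $1\le k\le n$, $\sigma_k\cdots\sigma_1\sigma_{k+1}\cdots\sigma_n$ is a flip of $\sigma$ if $k=n$ or $|\sigma_{k+1}|<\min\{|\sigma_i|:i\le k\}$; flip equivalence is the equivalence relation generated by flips, with classes $[\sigma]$. Signed maximum: for a nonempty word $\sigma$ of nonzero integers with distinct absolute values, write $\sigma=\sigma_L\hat\sigma\sigma_R$ with $|\hat\sigma|=\min|\sigma|$; (1) if $\sigma_L,\sigma_R$ empty, $\mathsf{smax}(\sigma)=\hat\sigma$; (2) if only $\sigma_L$ is empty: $\hat\sigma$ if $\hat\sigma>0$, else $\mathsf{smax}(\sigma_R)$; (3) if only $\sigma_R$ is empty: $\hat\sigma$ if $\hat\sigma>0$, else $\mathsf{smax}(\sigma_L)$; (4) both nonempty, $\hat\sigma>0$: $\mathsf{smax}(\sigma_L)$ if $\min|\sigma_L|>\min|\sigma_R|$, else $\mathsf{smax}(\sigma_R)$; (5) both nonempty, $\hat\sigma<0$: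 $\mathsf{smax}(\sigma_L)$ if $\min|\sigma_L|<\min|\sigma_R|$, else $\mathsf{smax}(\sigma_R)$. It is constant on flip classes. $\mathcal{FL}^{(B)}_n$ ($\mathcal{FL}^{(D)}_n$): classes with positive (negative) signed maximum; $\mathcal{FL}^{(B)}_{n,k}$: $\mathsf{smax}=k$; $\mathcal{FL}^{(D)}_{n,k}$: $\mathsf{smax}=-k$. $\mathcal{T}_n$: complete increasing binary trees with $n$ labelled nodes — plane rooted trees in which every node is a leaf or has two ordered children (left, right), exactly $n$ nodes labelled bijectively by $[n]$, all non-leaf nodes labelled (leaves labelled or empty), labels increasing from the root. Rightmost path $(v_1,\dots,v_d)$: $v_1$ the root, $v_{i+1}$ the right child of $v_i$, $v_d$ a leaf. $\mathcal{T}^\circ_n$ ($\mathcal{T}^*_n$): $v_d$ empty (labelled). Rightmost label: label of $v_{d-1}$ if $\tau\in\mathcal{T}^\circ_n$, of $v_d$ if $\tau\in\mathcal{T}^*_n$. $\mathcal{T}^\circ_{n,k}$, $\mathcal{T}^*_{n,k}$: rightmost label $k$. -}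

module Defs where

open import Data.Nat using (ℕ; zero; suc; _<_; _≤_; _⊓_; _≟_; _<ᵇ_)
open import Data.Integer using (ℤ; +_; -[1+_]; ∣_∣; -_)
open import Data.List using (List; []; _∷_; _++_; map; upTo; length; take; drop; reverse; foldr)
open import Data.List.Relation.Unary.All using (All)
open import Data.List.Relation.Binary.Permutation.Propositional using (_↭_)
open import Data.Bool using (Bool; true; false; if_then_else_)
open import Data.Product using (Σ; _×_; _,_; ∃)
open import Data.Sum using (_⊎_)
open import Data.Unit using (⊤)
open import Relation.Nullary using (yes; no)
open import Relation.Binary.PropositionalEquality using (_≡_)
open import Relation.Binary.Construct.Closure.Equivalence using (EqClosure)

oneTo : ℕ → List ℕ
oneTo n = map suc (upTo n)

IsSignedPerm : ℕ → List ℤ → Set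
IsSignedPerm n σ = map ∣_∣ σ ↭ oneTo n

SignedPerm : ℕ → Set
SignedPerm n = Σ (List ℤ) (IsSignedPerm n)

Flip : List ℤ → List ℤ → Set
Flip σ τ = Σ ℕ λ k → (1 ≤ k) × (k ≤ length σ)
  × (τ ≡ reverse (take k σ) ++ drop k σ)
  × ((k ≡ length σ) ⊎
     (Σ ℤ λ x → Σ (List ℤ) λ rest → (drop k σ ≡ x ∷ rest)
        × All (λ y → ∣ x ∣ < ∣ y ∣) (take k σ)))

FlipEquiv : {n : ℕ} → SignedPerm n → SignedPerm n → Set
FlipEquiv (σ , _) (τ , _) = EqClosure Flip σ τ

-- minimum absolute value of a (nonempty) word; 0 on the empty word (unused)
minAbs : List ℤ → ℕ
minAbs []       = 0
minAbs (x ∷ xs) = foldr (λ y acc → ∣ y ∣ ⊓ acc) ∣ x ∣ xs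

cut : ℕ → List ℤ → List ℤ × ℤ × List ℤ
cut m [] = [] , + 0 , []
cut m (x ∷ xs) with ∣ x ∣ ≟ m
... | yes _ = [] , x , xs
... | no _ with cut m xs
...   | L , h , R = x ∷ L , h , R

isPos : ℤ → Bool
isPos (+ zero)  = false
isPos (+ suc _) = true
isPos -[1+ _ ]  = false

-- smax with fuel (fuel = length suffices; recursive calls are on strictly
-- shorter words); value on the empty word is irrelevant
smaxF : ℕ → List ℤ → ℤ
smaxF zero    _  = + 0
smaxF (suc f) [] = + 0
smaxF (suc f) σ@(_ ∷ _) with cut (minAbs σ) σ
... | [] , h , [] = h
... | [] , h , R@(_ ∷ _) = if isPos h then h else smaxF f R
... | L@(_ ∷ _) , h , [] = if isPos h then h else smaxF f L
... | L@(_ ∷ _) , h , R@(_ ∷ _) =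
  if isPos h
  then (if minAbs R <ᵇ minAbs L then smaxF f L else smaxF f R)
  else (if minAbs L <ᵇ minAbs R then smaxF f L else smaxF f R)

smax : List ℤ → ℤ
smax σ = smaxF (length σ) σ

data Tree : Set where
  empty : Tree
  lf    : ℕ → Tree
  node  : ℕ → Tree → Tree → Tree

labels : Tree → List ℕ
labels empty        = []
labels (lf a)       = a ∷ []
labels (node a l r) = a ∷ labels l ++ labels r

Above : ℕ → Tree → Set
Above a empty        = ⊤
Above a (lf b)       = a < b
Above a (node b _ _) = a < b

Increasing : Tree → Set
Increasing empty        = ⊤
Increasing (lf _)       = ⊤
Increasing (node a l r) = Above a l × Above a r × Increasing l × Increasing r

InT : ℕ → Tree → Set
InT n τ = (labels τ ↭ oneTo n) × Increasing τ

-- end of the rightmost path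
data REnd : Set where
  circ : ℕ → REnd   -- v_d empty; carries the label of v_{d-1}
  star : ℕ → REnd   -- v_d labelled; carries its label
  none : REnd

rightEnd : Tree → REnd
rightEnd empty                        = none
rightEnd (lf a)                       = star a
rightEnd (node a l empty)             = circ a
rightEnd (node a l (lf b))            = star b
rightEnd (node a l (node b l' r'))    = rightEnd (node b l' r')

-- Cut a word σ with distinct absolute values at its letter h of smallest absolute value, σ = L h R.
-- A flip of σ either reverses a prefix inside L or reverses all of σ, because a longer prefix would be
-- followed by a letter smaller than h. So the flip class of σ is determined by h and the unordered pair
-- of classes of L and R, reversal of σ exchanging the two. Hanging the trees of L and R below the label
-- ∣ h ∣, with the subtree into which the signed maximum descends on the right, gives an increasing tree
-- whose rightmost path ends as smax σ prescribes. The sign of h can be read off the shape of the node,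
-- so the map is injective on classes, and reading a tree in order with these signs inverts it.

module Submission where

open import Defs
open import Data.Bool using (Bool; true; false; if_then_else_; not; T)
open import Data.Empty using (⊥-elim)
open import Data.Integer using (ℤ; +_; -[1+_]; ∣_∣; -_)
open import Data.Integer.Properties using (∣-i∣≡∣i∣; +-injective; neg-injective)
open import Data.List using (List; []; _∷_; _++_; [_]; map; length; reverse; foldr; upTo; take; drop)
open import Data.List.Properties
  using (map-++; ++-assoc; ++-identityʳ; reverse-++; unfold-reverse; length-map; length-upTo; length-++;
         take++drop≡id; drop-all; ∷-injective)
open import Data.List.Membership.Propositional using (_∈_)
open import Data.List.Membership.Propositional.Properties using (∈-∃++; ∈-++⁺ʳ; ∈-map⁻)
open import Data.List.Relation.Unary.All as All using (All; []; _∷_)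
import Data.List.Relation.Unary.All.Properties as All
open import Data.List.Relation.Unary.AllPairs using (AllPairs; []; _∷_)
import Data.List.Relation.Unary.AllPairs.Properties as AllPairs
open import Data.List.Relation.Unary.Any using (here; there)
import Data.List.Relation.Unary.Unique.Propositional.Properties as Unique
open import Data.List.Relation.Binary.Disjoint.Propositional using (Disjoint)
open import Data.List.Relation.Binary.Permutation.Propositional
  using (_↭_; ↭-refl; ↭-reflexive; ↭-sym; ↭-trans; prep; ↭⇒↭ₛ; module PermutationReasoning)
open import Data.List.Relation.Binary.Permutation.Propositional.Properties as Perm
  using (All-resp-↭; Any-resp-↭; ↭-reverse; ↭-length; ++⁺ʳ; ++⁺; ++-comm; shift)
open import Data.Nat using (ℕ; zero; suc; _+_; _≤_; _<_; _⊓_; _≟_; _<ᵇ_; z≤n; s≤s; s≤s⁻¹)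
open import Data.Nat.Properties
open import Data.Product using (Σ; _×_; _,_; proj₁; proj₂; ∃-syntax)
open import Data.Product.Properties using (,-injective)
open import Data.Sum using (_⊎_; inj₁; inj₂)
open import Data.Unit using (⊤; tt)
open import Function.Base using (_∘_)
open import Function.Bundles using (_⇔_; mk⇔)
open import Relation.Binary.PropositionalEquality hiding ([_])
open import Data.List.Relation.Binary.Permutation.Setoid.Properties (setoid ℕ) using (Unique-resp-↭)
open import Relation.Binary.Construct.Closure.Equivalence as EqClosure using (EqClosure)
open import Relation.Binary.Construct.Closure.ReflexiveTransitive using (ε; _◅_; _◅◅_)
open import Relation.Binary.Construct.Closure.Symmetric using (fwd; bwd)
import Relation.Binary.Reasoning.Setoid as SetoidReasoning
open import Relation.Nullary using (yes; no)
open import Relation.Nullary.Reflects using (ofʸ; ofⁿ)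

private
  variable
    x h : ℤ
    σ τ L L′ R R′ : List ℤ
    m n f : ℕ

_≺_ : ℤ → ℤ → Set
x ≺ y = ∣ x ∣ < ∣ y ∣

Distinct : List ℤ → Set
Distinct = AllPairs (λ x y → ∣ x ∣ ≢ ∣ y ∣)

minAbsFrom : ℕ → List ℤ → ℕ
minAbsFrom = foldr (λ y acc → ∣ y ∣ ⊓ acc)

minAbsFrom≤ : ∀ s xs → All (λ y → minAbsFrom s xs ≤ ∣ y ∣) xs
minAbsFrom≤ s []       = []
minAbsFrom≤ s (y ∷ ys) =
  m⊓n≤m ∣ y ∣ _ ∷ All.map (≤-trans (m⊓n≤n ∣ y ∣ _)) (minAbsFrom≤ s ys)

minAbsFrom-sel : ∀ s xs → minAbsFrom s xs ≡ s ⊎ ∃[ y ] (y ∈ xs × minAbsFrom s xs ≡ ∣ y ∣)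
minAbsFrom-sel s []       = inj₁ refl
minAbsFrom-sel s (y ∷ ys) with ⊓-sel ∣ y ∣ (minAbsFrom s ys)
... | inj₁ e = inj₂ (y , here refl , e)
... | inj₂ e with minAbsFrom-sel s ys
...   | inj₁ e′              = inj₁ (trans e e′)
...   | inj₂ (z , z∈ys , e′) = inj₂ (z , there z∈ys , trans e e′)

minAbs≤ : ∀ σ → All (λ y → minAbs σ ≤ ∣ y ∣) σ
minAbs≤ []       = []
minAbs≤ (x ∷ xs) = minAbsFrom-≤seed xs ∷ minAbsFrom≤ ∣ x ∣ xs
  where
  minAbsFrom-≤seed : ∀ xs → minAbsFrom ∣ x ∣ xs ≤ ∣ x ∣
  minAbsFrom-≤seed []       = ≤-refl
  minAbsFrom-≤seed (y ∷ ys) = ≤-trans (m⊓n≤n ∣ y ∣ _) (minAbsFrom-≤seed ys)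

minAbs-attained : ∀ x xs → ∃[ y ] (y ∈ x ∷ xs × minAbs (x ∷ xs) ≡ ∣ y ∣)
minAbs-attained x xs with minAbsFrom-sel ∣ x ∣ xs
... | inj₁ e              = x , here refl , e
... | inj₂ (y , y∈xs , e) = y , there y∈xs , e

minAbs-unique : h ∈ σ → All (λ y → ∣ h ∣ ≤ ∣ y ∣) σ → minAbs σ ≡ ∣ h ∣
minAbs-unique {σ = x ∷ xs} h∈σ h≤σ with minAbs-attained x xs
... | y , y∈σ , e =
  ≤-antisym (All.lookup (minAbs≤ (x ∷ xs)) h∈σ) (subst (_ ≤_) (sym e) (All.lookup h≤σ y∈σ))

minAbs-split : All (h ≺_) L → All (h ≺_) R → minAbs (L ++ h ∷ R) ≡ ∣ h ∣
minAbs-split {L = L} hL hR =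
  minAbs-unique (∈-++⁺ʳ L (here refl)) (All.++⁺ (All.map <⇒≤ hL) (≤-refl ∷ All.map <⇒≤ hR))

AllPairs-++⁻ : ∀ {A : Set} {Rel : A → A → Set} xs {ys} → AllPairs Rel (xs ++ ys) →
  AllPairs Rel xs × AllPairs Rel ys × All (λ x → All (Rel x) ys) xs
AllPairs-++⁻ []       rys         = [] , rys , []
AllPairs-++⁻ (x ∷ xs) (rx ∷ rxys) with AllPairs-++⁻ xs rxys
... | rxs , rys , rxsys = All.++⁻ˡ xs rx ∷ rxs , rys , All.++⁻ʳ xs rx ∷ rxsys

distinct-split : Distinct (L ++ h ∷ R) →
  Distinct L × Distinct R × All (λ y → ∣ y ∣ ≢ ∣ h ∣) L × All (λ y → ∣ h ∣ ≢ ∣ y ∣) R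
    × All (λ x → All (λ y → ∣ x ∣ ≢ ∣ y ∣) R) L
distinct-split {L = L} d with AllPairs-++⁻ L d
... | dL , hR ∷ dR , cross = dL , dR , All.map All.head cross , hR , All.map All.tail cross

data MinView : List ℤ → Set where
  []    : MinView []
  split : ∀ L h R → All (h ≺_) L → All (h ≺_) R → MinView (L ++ h ∷ R)

minView : ∀ σ → Distinct σ → MinView σ
minView []       _ = []
minView (x ∷ xs) d with minAbs-attained x xs
... | h , h∈σ , min≡h with ∈-∃++ h∈σ
...   | L , R , σ≡ with distinct-split {L = L} (subst Distinct σ≡ d)
...     | _ , _ , L≢h , h≢R , _ = subst MinView (sym σ≡) (split L h R
          (All.zipWith (λ (le , ne) → ≤∧≢⇒< le (ne ∘ sym)) (All.++⁻ˡ L h≤σ , L≢h))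
          (All.zipWith (λ (le , ne) → ≤∧≢⇒< le ne) (All.tail (All.++⁻ʳ L h≤σ) , h≢R)))
  where
  h≤σ : All (λ y → ∣ h ∣ ≤ ∣ y ∣) (L ++ h ∷ R)
  h≤σ = subst₂ (λ s m → All (λ y → m ≤ ∣ y ∣) s) σ≡ min≡h (minAbs≤ (x ∷ xs))

cut-at : ∀ L → All (h ≺_) L → cut ∣ h ∣ (L ++ h ∷ R) ≡ (L , h , R)
cut-at {h} [] [] with ∣ h ∣ ≟ ∣ h ∣
... | yes _ = refl
... | no ≢  = ⊥-elim (≢ refl)
cut-at {h} (x ∷ L) (h≺x ∷ hL) with ∣ x ∣ ≟ ∣ h ∣
... | yes e = ⊥-elim (<-irrefl (sym e) h≺x)
... | no _  = cong (λ c → x ∷ proj₁ c , proj₂ c) (cut-at L hL)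

cut-min : All (h ≺_) L → All (h ≺_) R → cut (minAbs (L ++ h ∷ R)) (L ++ h ∷ R) ≡ (L , h , R)
cut-min {h} {L} {R} hL hR = trans (cong (λ m → cut m (L ++ h ∷ R)) (minAbs-split hL hR)) (cut-at L hL)

CanFlip : List ℤ → List ℤ → Set
CanFlip P []      = ⊤
CanFlip P (y ∷ _) = All (y ≺_) P

data PrefixFlip : List ℤ → List ℤ → Set where
  prefix-flip : ∀ x P S → CanFlip (x ∷ P) S → PrefixFlip (x ∷ P ++ S) (reverse (x ∷ P) ++ S)

take-length-++ : ∀ {A : Set} (xs ys : List A) → take (length xs) (xs ++ ys) ≡ xs
take-length-++ []       ys = refl
take-length-++ (x ∷ xs) ys = cong (x ∷_) (take-length-++ xs ys)

drop-length-++ : ∀ {A : Set} (xs ys : List A) → drop (length xs) (xs ++ ys) ≡ ys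
drop-length-++ []       ys = refl
drop-length-++ (x ∷ xs) ys = drop-length-++ xs ys

FlipCondition : List ℤ → ℕ → Set
FlipCondition σ k = (k ≡ length σ) ⊎ (Σ ℤ λ y → Σ (List ℤ) λ rest →
  (drop k σ ≡ y ∷ rest) × All (λ z → ∣ y ∣ < ∣ z ∣) (take k σ))

flip⇒prefixFlip : Flip σ τ → PrefixFlip σ τ
flip⇒prefixFlip {x ∷ σ} (suc k , _ , _ , refl , cond) =
  subst (λ s → PrefixFlip s (reverse (x ∷ take k σ) ++ drop k σ)) (cong (x ∷_) (take++drop≡id k σ))
    (prefix-flip x (take k σ) (drop k σ) (canFlip cond))
  where
  canFlip : FlipCondition (x ∷ σ) (suc k) → CanFlip (x ∷ take k σ) (drop k σ)
  canFlip (inj₁ k≡) rewrite drop-all k σ (≤-reflexive (suc-injective (sym k≡))) = tt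
  canFlip (inj₂ (_ , _ , drop≡ , y≺)) rewrite drop≡ = y≺

prefixFlip⇒flip : PrefixFlip σ τ → Flip σ τ
prefixFlip⇒flip (prefix-flip x P S c) =
  suc (length P) , s≤s z≤n , s≤s (subst (length P ≤_) (sym (length-++ P)) (m≤m+n _ _)) ,
  cong₂ (λ Q T → reverse (x ∷ Q) ++ T) (sym (take-length-++ P S)) (sym (drop-length-++ P S)) ,
  cond S c
  where
  cond : ∀ S → CanFlip (x ∷ P) S → FlipCondition (x ∷ P ++ S) (suc (length P))
  cond []      _ = inj₁ (cong (λ Q → length (x ∷ Q)) (sym (++-identityʳ P)))
  cond (y ∷ S) c = inj₂ (y , S , drop-length-++ P (y ∷ S) ,
                         subst (λ Q → All (y ≺_) (x ∷ Q)) (sym (take-length-++ P (y ∷ S))) c)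

prefixFlip-↭ : PrefixFlip σ τ → σ ↭ τ
prefixFlip-↭ (prefix-flip x P S _) = ++⁺ʳ S (↭-sym (↭-reverse (x ∷ P)))

reverse-++-∷ : ∀ L (h : ℤ) R → reverse (L ++ h ∷ R) ≡ reverse R ++ h ∷ reverse L
reverse-++-∷ L h R = begin
  reverse (L ++ h ∷ R)          ≡⟨ reverse-++ L (h ∷ R) ⟩
  reverse (h ∷ R) ++ reverse L  ≡⟨ cong (_++ reverse L) (unfold-reverse h R) ⟩
  (reverse R ++ [ h ]) ++ reverse L ≡⟨ ++-assoc (reverse R) [ h ] (reverse L) ⟩
  reverse R ++ h ∷ reverse L    ∎
  where open ≡-Reasoning

prefixFlip-reverse : ∀ x σ → PrefixFlip (x ∷ σ) (reverse (x ∷ σ))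
prefixFlip-reverse x σ =
  subst₂ PrefixFlip (++-identityʳ (x ∷ σ)) (++-identityʳ (reverse (x ∷ σ))) (prefix-flip x σ [] tt)

prefixFlip-lift : All (h ≺_) L → PrefixFlip L L′ → PrefixFlip (L ++ h ∷ R) (L′ ++ h ∷ R)
prefixFlip-lift {h} {R = R} hL (prefix-flip x P S c) =
  subst₂ PrefixFlip (cong (x ∷_) (sym (++-assoc P S (h ∷ R)))) (sym (++-assoc (reverse (x ∷ P)) S (h ∷ R)))
    (prefix-flip x P (S ++ h ∷ R) (canFlip S c))
  where
  canFlip : ∀ S → CanFlip (x ∷ P) S → CanFlip (x ∷ P) (S ++ h ∷ R)
  canFlip []      _ = All.++⁻ˡ (x ∷ P) hL
  canFlip (_ ∷ _) c = c

++-split : ∀ (A B L : List ℤ) → A ++ B ≡ L ++ h ∷ R →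
  (∃[ Q ] L ≡ A ++ Q × B ≡ Q ++ h ∷ R) ⊎ (∃[ R₁ ] A ≡ L ++ h ∷ R₁ × R ≡ R₁ ++ B)
++-split []      B L       e    = inj₁ (L , refl , e)
++-split (a ∷ A) B []      refl = inj₂ (A , refl , refl)
++-split (a ∷ A) B (l ∷ L) e with ∷-injective e
... | refl , e′ with ++-split A B L e′
...   | inj₁ (Q , refl , B≡)  = inj₁ (Q , refl , B≡)
...   | inj₂ (R₁ , refl , R≡) = inj₂ (R₁ , refl , R≡)

-- A flip of L h R either stays inside L or, as h is smaller than everything after it, reverses the whole word.
prefixFlip-split : All (h ≺_) R → PrefixFlip σ τ → σ ≡ L ++ h ∷ R →
  (∃[ L′ ] PrefixFlip L L′ × τ ≡ L′ ++ h ∷ R) ⊎ τ ≡ reverse R ++ h ∷ reverse L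
prefixFlip-split {h} {R} {L = L} hR (prefix-flip x P S c) e with ++-split (x ∷ P) S L e
... | inj₁ (Q , refl , refl) =
  inj₁ (reverse (x ∷ P) ++ Q , prefix-flip x P Q (canFlip Q c) , sym (++-assoc (reverse (x ∷ P)) Q (h ∷ R)))
  where
  canFlip : ∀ Q → CanFlip (x ∷ P) (Q ++ h ∷ R) → CanFlip (x ∷ P) Q
  canFlip []      _ = tt
  canFlip (_ ∷ _) c = c
... | inj₂ (R₁ , xP≡ , refl) = whole S c hR
  where
  whole : ∀ S → CanFlip (x ∷ P) S → All (h ≺_) (R₁ ++ S) → (∃[ L′ ] PrefixFlip L L′ × reverse (x ∷ P) ++ S ≡ L′ ++ h ∷ R₁ ++ S)
                                    ⊎ reverse (x ∷ P) ++ S ≡ reverse (R₁ ++ S) ++ h ∷ reverse L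
  whole [] _ _ = inj₂ (begin
    reverse (x ∷ P) ++ []        ≡⟨ ++-identityʳ _ ⟩
    reverse (x ∷ P)              ≡⟨ cong reverse xP≡ ⟩
    reverse (L ++ h ∷ R₁)        ≡⟨ reverse-++-∷ L h R₁ ⟩
    reverse R₁ ++ h ∷ reverse L  ≡⟨ cong (λ Q → reverse Q ++ h ∷ reverse L) (++-identityʳ R₁) ⟨
    reverse (R₁ ++ []) ++ h ∷ reverse L ∎)
    where open ≡-Reasoning
  whole (y ∷ S) y≺xP hR = ⊥-elim (<-asym h≺y y≺h)
    where
    y≺h : y ≺ h
    y≺h = All.head (All.++⁻ʳ L (subst (All (y ≺_)) xP≡ y≺xP))
    h≺y : h ≺ y
    h≺y = All.head (All.++⁻ʳ R₁ hR)

infix 4 _∼_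
_∼_ : List ℤ → List ℤ → Set
_∼_ = EqClosure PrefixFlip

∼-sym : σ ∼ τ → τ ∼ σ
∼-sym = EqClosure.symmetric PrefixFlip

∼-reverse : ∀ σ → σ ∼ reverse σ
∼-reverse []      = ε
∼-reverse (x ∷ σ) = EqClosure.return (prefixFlip-reverse x σ)

∼-lift : All (h ≺_) L → L ∼ L′ → L ++ h ∷ R ∼ L′ ++ h ∷ R
∼-lift hL ε            = ε
∼-lift hL (fwd p ◅ ps) = fwd (prefixFlip-lift hL p) ◅ ∼-lift (All-resp-↭ (prefixFlip-↭ p) hL) ps
∼-lift {h} hL (_◅_ {j = L′} (bwd p) ps) = bwd (prefixFlip-lift hL′ p) ◅ ∼-lift hL′ ps
  where
  hL′ : All (h ≺_) L′
  hL′ = All-resp-↭ (↭-sym (prefixFlip-↭ p)) hL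

-- R can only be flipped inside after the flip of the whole word has moved it to the left of h.
∼-++-∷ : All (h ≺_) L → All (h ≺_) R → L ∼ L′ → R ∼ R′ → L ++ h ∷ R ∼ L′ ++ h ∷ R′
∼-++-∷ {h} {L} {R} {L′} {R′} hL hR L∼L′ R∼R′ = begin
  L ++ h ∷ R                   ≈⟨ ∼-lift hL L∼L′ ⟩
  L′ ++ h ∷ R                  ≈⟨ ∼-reverse _ ⟩
  reverse (L′ ++ h ∷ R)        ≡⟨ reverse-++-∷ L′ h R ⟩
  reverse R ++ h ∷ reverse L′  ≈⟨ ∼-lift (All-resp-↭ (↭-sym (↭-reverse R)) hR) revR∼revR′ ⟩
  reverse R′ ++ h ∷ reverse L′ ≡⟨ reverse-++-∷ L′ h R′ ⟨
  reverse (L′ ++ h ∷ R′)       ≈⟨ ∼-reverse _ ⟨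
  L′ ++ h ∷ R′                 ∎
  where
  open SetoidReasoning (EqClosure.setoid PrefixFlip)
  revR∼revR′ : reverse R ∼ reverse R′
  revR∼revR′ = ∼-sym (∼-reverse R) ◅◅ R∼R′ ◅◅ ∼-reverse R′

isEmpty : Tree → Bool
isEmpty empty        = true
isEmpty (lf _)       = false
isEmpty (node _ _ _) = false

root : Tree → ℕ
root empty        = 0
root (lf a)       = a
root (node a _ _) = a

data EmptyView : Tree → Set where
  empty    : EmptyView empty
  nonempty : ∀ {t} → isEmpty t ≡ false → EmptyView t

emptyView : ∀ t → EmptyView t
emptyView empty        = empty
emptyView (lf _)       = nonempty refl
emptyView (node _ _ _) = nonempty refl

-- The subtree into which the signed maximum descends becomes the right child; where it stops at h the
-- right child is empty, except that a negative h without subtrees becomes a labelled leaf.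
join : ℤ → Tree → Tree → Tree
join h a b = place (isPos h) (isEmpty a) (isEmpty b)
  where
  place : Bool → Bool → Bool → Tree
  place true  true  true  = node ∣ h ∣ empty empty
  place false true  true  = lf ∣ h ∣
  place true  true  false = node ∣ h ∣ b empty
  place false true  false = node ∣ h ∣ empty b
  place true  false true  = node ∣ h ∣ a empty
  place false false true  = node ∣ h ∣ empty a
  place true  false false = if root b <ᵇ root a then node ∣ h ∣ b a else node ∣ h ∣ a b
  place false false false = if root a <ᵇ root b then node ∣ h ∣ b a else node ∣ h ∣ a b

join-cases : ∀ h a b → (a ≡ empty × b ≡ empty × join h a b ≡ lf ∣ h ∣)
           ⊎ (join h a b ≡ node ∣ h ∣ a b) ⊎ (join h a b ≡ node ∣ h ∣ b a)
join-cases h a b with emptyView a | emptyView b | isPos h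
... | empty       | empty       | true  = inj₂ (inj₁ refl)
... | empty       | empty       | false = inj₁ (refl , refl , refl)
... | empty       | nonempty eb | true  rewrite eb = inj₂ (inj₂ refl)
... | empty       | nonempty eb | false rewrite eb = inj₂ (inj₁ refl)
... | nonempty ea | empty       | true  rewrite ea = inj₂ (inj₁ refl)
... | nonempty ea | empty       | false rewrite ea = inj₂ (inj₂ refl)
... | nonempty ea | nonempty eb | true  rewrite ea | eb with root b <ᵇ root a
...   | true  = inj₂ (inj₂ refl)
...   | false = inj₂ (inj₁ refl)
join-cases h a b | nonempty ea | nonempty eb | false rewrite ea | eb with root a <ᵇ root b
...   | true  = inj₂ (inj₂ refl)
...   | false = inj₂ (inj₁ refl)

join-nonempty : ∀ h a b → isEmpty (join h a b) ≡ false
join-nonempty h a b with join-cases h a b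
... | inj₁ (_ , _ , e)  rewrite e = refl
... | inj₂ (inj₁ e)     rewrite e = refl
... | inj₂ (inj₂ e)     rewrite e = refl

root-join : ∀ h a b → root (join h a b) ≡ ∣ h ∣
root-join h a b with join-cases h a b
... | inj₁ (_ , _ , e)  rewrite e = refl
... | inj₂ (inj₁ e)     rewrite e = refl
... | inj₂ (inj₂ e)     rewrite e = refl

labels-join : ∀ h a b → labels (join h a b) ↭ ∣ h ∣ ∷ labels a ++ labels b
labels-join h a b with join-cases h a b
... | inj₁ (refl , refl , e) rewrite e = ↭-refl
... | inj₂ (inj₁ e)          rewrite e = ↭-refl
... | inj₂ (inj₂ e)          rewrite e = prep ∣ h ∣ (++-comm (labels b) (labels a))

All<⇒Above : ∀ t → All (m <_) (labels t) → Above m t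
All<⇒Above empty        _       = tt
All<⇒Above (lf _)       (p ∷ _) = p
All<⇒Above (node _ _ _) (p ∷ _) = p

increasing-join : ∀ h a b → Increasing a → Increasing b →
  All (∣ h ∣ <_) (labels a) → All (∣ h ∣ <_) (labels b) → Increasing (join h a b)
increasing-join h a b ia ib ha hb with join-cases h a b
... | inj₁ (_ , _ , e) rewrite e = tt
... | inj₂ (inj₁ e)    rewrite e = All<⇒Above a ha , All<⇒Above b hb , ia , ib
... | inj₂ (inj₂ e)    rewrite e = All<⇒Above b hb , All<⇒Above a ha , ib , ia

children : Tree → Tree × Tree
children empty        = empty , empty
children (lf _)       = empty , empty
children (node _ l r) = l , r

children-join : ∀ h a b → children (join h a b) ≡ (a , b) ⊎ children (join h a b) ≡ (b , a)
children-join h a b with join-cases h a b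
... | inj₁ (refl , refl , e) rewrite e = inj₁ refl
... | inj₂ (inj₁ e)          rewrite e = inj₁ refl
... | inj₂ (inj₂ e)          rewrite e = inj₂ refl

<ᵇ-flip : m ≢ n → (n <ᵇ m) ≡ not (m <ᵇ n)
<ᵇ-flip {m} {n} m≢n with m <ᵇ n | <ᵇ-reflects-< m n | n <ᵇ m | <ᵇ-reflects-< n m
... | true  | ofʸ m<n | true  | ofʸ n<m = ⊥-elim (<-asym m<n n<m)
... | true  | _       | false | _       = refl
... | false | _       | true  | _       = refl
... | false | ofⁿ m≮n | false | ofⁿ n≮m = ⊥-elim (m≢n (≤-antisym (≮⇒≥ n≮m) (≮⇒≥ m≮n)))

<ᵇ-asym : (m <ᵇ n) ≡ true → (n <ᵇ m) ≡ false
<ᵇ-asym {m} {n} m<ᵇn with n <ᵇ m | <ᵇ-reflects-< n m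
... | true  | ofʸ n<m = ⊥-elim (<-asym n<m (<ᵇ⇒< m n (subst T (sym m<ᵇn) tt)))
... | false | _       = refl

root∈labels : ∀ t → isEmpty t ≡ false → root t ∈ labels t
root∈labels (lf _)       _ = here refl
root∈labels (node _ _ _) _ = here refl

roots-differ : ∀ {a b} → Disjoint (labels a) (labels b) → isEmpty a ≡ false → isEmpty b ≡ false → root a ≢ root b
roots-differ {a} {b} disj ea eb a≡b = disj (root∈labels a ea , subst (_∈ labels b) (sym a≡b) (root∈labels b eb))

join-comm : ∀ h a b → Disjoint (labels a) (labels b) → join h a b ≡ join h b a
join-comm h a b disj with emptyView a | emptyView b | isPos h
... | empty       | empty       | _     = refl
... | empty       | nonempty eb | true  rewrite eb = refl
... | empty       | nonempty eb | false rewrite eb = refl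
... | nonempty ea | empty       | true  rewrite ea = refl
... | nonempty ea | empty       | false rewrite ea = refl
... | nonempty ea | nonempty eb | true  rewrite ea | eb | <ᵇ-flip (roots-differ disj ea eb) with root a <ᵇ root b
...   | true  = refl
...   | false = refl
join-comm h a b disj | nonempty ea | nonempty eb | false rewrite ea | eb | <ᵇ-flip (roots-differ disj ea eb) with root a <ᵇ root b
...   | true  = refl
...   | false = refl

positiveNode : Tree → Tree → Bool
positiveNode l r = if isEmpty r then true else if isEmpty l then false else root l <ᵇ root r

rootLetter : Tree → ℤ
rootLetter empty        = + 0
rootLetter (lf a)       = - (+ a)
rootLetter (node a l r) = if positiveNode l r then + a else - (+ a)

isPos⇒+∣i∣≡i : isPos h ≡ true → + ∣ h ∣ ≡ h
isPos⇒+∣i∣≡i {+ suc _} _ = refl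

¬isPos⇒-∣i∣≡i : isPos h ≡ false → - (+ ∣ h ∣) ≡ h
¬isPos⇒-∣i∣≡i {+ zero}   _ = refl
¬isPos⇒-∣i∣≡i { -[1+ _ ]} _ = refl

rootLetter-join : ∀ h a b → Disjoint (labels a) (labels b) → rootLetter (join h a b) ≡ h
rootLetter-join h a b disj with emptyView a | emptyView b | isPos h in pos
... | empty       | empty       | true  = isPos⇒+∣i∣≡i pos
... | empty       | empty       | false = ¬isPos⇒-∣i∣≡i pos
... | empty       | nonempty eb | true  rewrite eb = isPos⇒+∣i∣≡i pos
... | empty       | nonempty eb | false rewrite eb | eb = ¬isPos⇒-∣i∣≡i pos
... | nonempty ea | empty       | true  rewrite ea = isPos⇒+∣i∣≡i pos
... | nonempty ea | empty       | false rewrite ea | ea = ¬isPos⇒-∣i∣≡i pos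
... | nonempty ea | nonempty eb | true  rewrite ea | eb with root b <ᵇ root a in b<a
...   | true  rewrite ea | eb | b<a = isPos⇒+∣i∣≡i pos
...   | false rewrite ea | eb | <ᵇ-flip (≢-sym (roots-differ disj ea eb)) | b<a = isPos⇒+∣i∣≡i pos
rootLetter-join h a b disj | nonempty ea | nonempty eb | false rewrite ea | eb with root a <ᵇ root b in a<b
...   | true  rewrite ea | eb | <ᵇ-flip (roots-differ disj ea eb) | a<b = ¬isPos⇒-∣i∣≡i pos
...   | false rewrite ea | eb | a<b = ¬isPos⇒-∣i∣≡i pos

join-leaf : ∀ n → join (- (+ n)) empty empty ≡ lf n
join-leaf zero    = refl
join-leaf (suc n) = refl

join-node : ∀ n l r → join (rootLetter (node (suc n) l r)) l r ≡ node (suc n) l r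
join-node n l r with emptyView l | emptyView r
... | empty       | empty       = refl
... | nonempty el | empty       rewrite el = refl
... | empty       | nonempty er rewrite er = refl
... | nonempty el | nonempty er rewrite el | er with root l <ᵇ root r in l<r
...   | true  rewrite <ᵇ-asym {root l} {root r} l<r = refl
...   | false rewrite l<r = refl

join≢empty : ∀ h a b → join h a b ≢ empty
join≢empty h a b e with trans (sym (cong isEmpty e)) (join-nonempty h a b)
... | ()

join-injective : ∀ h a b h′ a′ b′ → Disjoint (labels a) (labels b) → Disjoint (labels a′) (labels b′) →
  join h a b ≡ join h′ a′ b′ → h ≡ h′ × ((a ≡ a′ × b ≡ b′) ⊎ (a ≡ b′ × b ≡ a′))
join-injective h a b h′ a′ b′ disj disj′ e =
  trans (sym (rootLetter-join h a b disj)) (trans (cong rootLetter e) (rootLetter-join h′ a′ b′ disj′)) ,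
  subtrees (children-join h a b) (children-join h′ a′ b′)
  where
  same : children (join h a b) ≡ children (join h′ a′ b′)
  same = cong children e
  subtrees : children (join h a b) ≡ (a , b) ⊎ children (join h a b) ≡ (b , a) →
             children (join h′ a′ b′) ≡ (a′ , b′) ⊎ children (join h′ a′ b′) ≡ (b′ , a′) →
             (a ≡ a′ × b ≡ b′) ⊎ (a ≡ b′ × b ≡ a′)
  subtrees (inj₁ c) (inj₁ c′) = inj₁ (,-injective (trans (sym c) (trans same c′)))
  subtrees (inj₁ c) (inj₂ c′) = inj₂ (,-injective (trans (sym c) (trans same c′)))
  subtrees (inj₂ c) (inj₁ c′) with ,-injective (trans (sym c) (trans same c′))
  ... | b≡a′ , a≡b′ = inj₂ (a≡b′ , b≡a′)
  subtrees (inj₂ c) (inj₂ c′) with ,-injective (trans (sym c) (trans same c′))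
  ... | b≡b′ , a≡a′ = inj₁ (a≡a′ , b≡b′)

toTree : ℕ → List ℤ → Tree
toTree zero    _         = empty
toTree (suc f) []        = empty
toTree (suc f) σ@(_ ∷ _) = let L , h , R = cut (minAbs σ) σ in join h (toTree f L) (toTree f R)

toTree-[] : ∀ f → toTree f [] ≡ empty
toTree-[] zero    = refl
toTree-[] (suc f) = refl

toTree-split : All (h ≺_) L → All (h ≺_) R → toTree (suc f) (L ++ h ∷ R) ≡ join h (toTree f L) (toTree f R)
toTree-split {h} {[]}    {R} {f} hL hR = cong (λ (L , h , R) → join h (toTree f L) (toTree f R)) (cut-min {h} {[]} {R} hL hR)
toTree-split {h} {_ ∷ _} {R} {f} hL hR = cong (λ (L , h , R) → join h (toTree f L) (toTree f R)) (cut-min {h} {_} {R} hL hR)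

Fits : ℕ → List ℤ → Set
Fits f σ = length σ ≤ f × Distinct σ

distinct-resp-↭ : σ ↭ τ → Distinct σ → Distinct τ
distinct-resp-↭ σ↭τ d = AllPairs.map⁻ (Unique-resp-↭ (↭⇒↭ₛ (Perm.map⁺ ∣_∣ σ↭τ)) (AllPairs.map⁺ d))

fits-resp-↭ : σ ↭ τ → Fits f σ → Fits f τ
fits-resp-↭ σ↭τ (len , d) = subst (_≤ _) (↭-length σ↭τ) len , distinct-resp-↭ σ↭τ d

length-split : length (L ++ h ∷ R) ≤ suc f → length L ≤ f × length R ≤ f
length-split {L = L} {R = R} {f = f} len = m+n≤o⇒m≤o (length L) len′ , m+n≤o⇒n≤o (length L) len′
  where
  len′ : length L + length R ≤ f
  len′ = s≤s⁻¹ (subst (_≤ _) (trans (length-++ L) (+-suc (length L) (length R))) len)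

fits-split : Fits (suc f) (L ++ h ∷ R) → Fits f L × Fits f R
fits-split {L = L} (len , d) with length-split {L = L} len | distinct-split {L = L} d
... | lenL , lenR | dL , dR , _ = (lenL , dL) , (lenR , dR)

toTree-labels : Fits f σ → labels (toTree f σ) ↭ map ∣_∣ σ
toTree-labels {zero}  {[]} _ = ↭-refl
toTree-labels {suc f} {σ} (len , d) with minView σ d
... | [] = ↭-refl
... | split L h R hL hR with fits-split {L = L} (len , d)
...   | fitsL , fitsR = begin
  labels (toTree (suc f) (L ++ h ∷ R))                  ≡⟨ cong labels (toTree-split hL hR) ⟩
  labels (join h (toTree f L) (toTree f R))             ↭⟨ labels-join h _ _ ⟩
  ∣ h ∣ ∷ labels (toTree f L) ++ labels (toTree f R)    ↭⟨ prep ∣ h ∣ (++⁺ (toTree-labels fitsL) (toTree-labels fitsR)) ⟩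
  ∣ h ∣ ∷ map ∣_∣ L ++ map ∣_∣ R                        ↭⟨ shift ∣ h ∣ (map ∣_∣ L) (map ∣_∣ R) ⟨
  map ∣_∣ L ++ ∣ h ∣ ∷ map ∣_∣ R                        ≡⟨ map-++ ∣_∣ L (h ∷ R) ⟨
  map ∣_∣ (L ++ h ∷ R)                                  ∎
  where open PermutationReasoning

labels-above : Fits f L → All (h ≺_) L → All (∣ h ∣ <_) (labels (toTree f L))
labels-above fitsL hL = All-resp-↭ (↭-sym (toTree-labels fitsL)) (All.map⁺ hL)

toTree-increasing : Fits f σ → Increasing (toTree f σ)
toTree-increasing {zero}  {[]} _ = tt
toTree-increasing {suc f} {σ} (len , d) with minView σ d
... | [] = tt
... | split L h R hL hR with fits-split {L = L} (len , d)
...   | fitsL , fitsR = subst Increasing (sym (toTree-split hL hR))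
          (increasing-join h _ _ (toTree-increasing fitsL) (toTree-increasing fitsR)
            (labels-above {h = h} fitsL hL) (labels-above {h = h} fitsR hR))

toTree-disjoint : Fits (suc f) (L ++ h ∷ R) → Disjoint (labels (toTree f L)) (labels (toTree f R))
toTree-disjoint {L = L} fits (v∈a , v∈b) with fits-split {L = L} fits | distinct-split {L = L} (proj₂ fits)
... | fitsL , fitsR | _ , _ , _ , _ , apart
  with ∈-map⁻ ∣_∣ (Any-resp-↭ (toTree-labels fitsL) v∈a) | ∈-map⁻ ∣_∣ (Any-resp-↭ (toTree-labels fitsR) v∈b)
...   | x , x∈L , v≡x | y , y∈R , v≡y = All.lookup (All.lookup apart x∈L) y∈R (trans (sym v≡x) v≡y)

toTree-prefixFlip : Fits f σ → PrefixFlip σ τ → toTree f σ ≡ toTree f τ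
toTree-prefixFlip {zero} {[]} _ ()
toTree-prefixFlip {suc f} {σ} {τ} fits@(_ , d) p with minView σ d
... | [] with p
...   | ()
toTree-prefixFlip {suc f} fits p | split L h R hL hR with fits-split {L = L} fits | prefixFlip-split hR p refl
... | fitsL , fitsR | inj₁ (L′ , pL , refl) = begin
  toTree (suc f) (L ++ h ∷ R)        ≡⟨ toTree-split hL hR ⟩
  join h (toTree f L) (toTree f R)   ≡⟨ cong (λ t → join h t (toTree f R)) (toTree-prefixFlip fitsL pL) ⟩
  join h (toTree f L′) (toTree f R)  ≡⟨ toTree-split (All-resp-↭ (prefixFlip-↭ pL) hL) hR ⟨
  toTree (suc f) (L′ ++ h ∷ R)       ∎
  where open ≡-Reasoning
... | fitsL , fitsR | inj₂ refl = begin
  toTree (suc f) (L ++ h ∷ R)                               ≡⟨ toTree-split hL hR ⟩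
  join h (toTree f L) (toTree f R)                          ≡⟨ join-comm h _ _ (toTree-disjoint fits) ⟩
  join h (toTree f R) (toTree f L)                          ≡⟨ cong₂ (join h) (toTree-reverse fitsR) (toTree-reverse fitsL) ⟩
  join h (toTree f (reverse R)) (toTree f (reverse L))      ≡⟨ toTree-split (All-resp-↭ (↭-sym (↭-reverse R)) hR)
                                                                            (All-resp-↭ (↭-sym (↭-reverse L)) hL) ⟨
  toTree (suc f) (reverse R ++ h ∷ reverse L)               ∎
  where
  open ≡-Reasoning
  toTree-reverse : Fits f σ → toTree f σ ≡ toTree f (reverse σ)
  toTree-reverse {[]}    _    = refl
  toTree-reverse {x ∷ σ} fits = toTree-prefixFlip fits (prefixFlip-reverse x σ)

toTree-∼ : Fits f σ → σ ∼ τ → toTree f σ ≡ toTree f τ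
toTree-∼ fits ε            = refl
toTree-∼ fits (fwd p ◅ ps) = trans (toTree-prefixFlip fits p) (toTree-∼ (fits-resp-↭ (prefixFlip-↭ p) fits) ps)
toTree-∼ {f} fits (_◅_ {j = σ′} (bwd p) ps) = trans (sym (toTree-prefixFlip fits′ p)) (toTree-∼ fits′ ps)
  where
  fits′ : Fits f σ′
  fits′ = fits-resp-↭ (↭-sym (prefixFlip-↭ p)) fits

toTree-injective : Fits f σ → Fits f τ → toTree f σ ≡ toTree f τ → σ ∼ τ
toTree-injective {zero}  {[]} {[]} _ _ _ = ε
toTree-injective {suc f} {σ} {τ} fitsσ@(_ , dσ) fitsτ@(_ , dτ) e with minView σ dσ | minView τ dτ
... | [] | []                = ε
... | [] | split L h R hL hR = ⊥-elim (join≢empty h _ _ (sym (trans e (toTree-split hL hR))))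
... | split L h R hL hR | [] = ⊥-elim (join≢empty h _ _ (trans (sym (toTree-split hL hR)) e))
... | split L h R hL hR | split L′ h′ R′ hL′ hR′
  with fits-split {L = L} fitsσ | fits-split {L = L′} fitsτ
     | join-injective h _ _ h′ _ _ (toTree-disjoint fitsσ) (toTree-disjoint fitsτ)
                      (trans (sym (toTree-split hL hR)) (trans e (toTree-split hL′ hR′)))
...   | fitsL , fitsR | fitsL′ , fitsR′ | refl , inj₁ (L≡L′ , R≡R′) =
  ∼-++-∷ hL hR (toTree-injective fitsL fitsL′ L≡L′) (toTree-injective fitsR fitsR′ R≡R′)
...   | fitsL , fitsR | fitsL′ , fitsR′ | refl , inj₂ (L≡R′ , R≡L′) = begin
  L ++ h ∷ R                    ≈⟨ ∼-++-∷ hL hR (toTree-injective fitsL fitsR′ L≡R′ ◅◅ ∼-reverse R′)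
                                                (toTree-injective fitsR fitsL′ R≡L′ ◅◅ ∼-reverse L′) ⟩
  reverse R′ ++ h ∷ reverse L′  ≡⟨ reverse-++-∷ L′ h R′ ⟨
  reverse (L′ ++ h ∷ R′)        ≈⟨ ∼-reverse _ ⟨
  L′ ++ h ∷ R′                  ∎
  where open SetoidReasoning (EqClosure.setoid PrefixFlip)

smaxStep : ℤ → List ℤ → List ℤ → ℤ → ℤ → ℤ
smaxStep h []      []      sL sR = h
smaxStep h []      (_ ∷ _) sL sR = if isPos h then h else sR
smaxStep h (_ ∷ _) []      sL sR = if isPos h then h else sL
smaxStep h L@(_ ∷ _) R@(_ ∷ _) sL sR =
  if isPos h then (if minAbs R <ᵇ minAbs L then sL else sR)
             else (if minAbs L <ᵇ minAbs R then sL else sR)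

smaxF-cut : ∀ x xs → cut (minAbs (x ∷ xs)) (x ∷ xs) ≡ (L , h , R) →
  smaxF (suc f) (x ∷ xs) ≡ smaxStep h L R (smaxF f L) (smaxF f R)
smaxF-cut x xs e with cut (minAbs (x ∷ xs)) (x ∷ xs) | e
smaxF-cut {L = []}    {R = []}    x xs _ | _ | refl = refl
smaxF-cut {L = []}    {R = _ ∷ _} x xs _ | _ | refl = refl
smaxF-cut {L = _ ∷ _} {R = []}    x xs _ | _ | refl = refl
smaxF-cut {L = _ ∷ _} {R = _ ∷ _} x xs _ | _ | refl = refl

smaxF-split : All (h ≺_) L → All (h ≺_) R → smaxF (suc f) (L ++ h ∷ R) ≡ smaxStep h L R (smaxF f L) (smaxF f R)
smaxF-split {h} {[]}    {R} hL hR = smaxF-cut h R (cut-min {h} {[]} {R} hL hR)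
smaxF-split {h} {x ∷ L} {R} hL hR = smaxF-cut x (L ++ h ∷ R) (cut-min {h} {x ∷ L} {R} hL hR)

Rooted : List ℤ → Tree → Set
Rooted []        t = t ≡ empty
Rooted σ@(_ ∷ _) t = isEmpty t ≡ false × root t ≡ minAbs σ

toTree-rooted : Fits f σ → Rooted σ (toTree f σ)
toTree-rooted {zero}  {[]} _ = refl
toTree-rooted {suc f} {σ} (_ , d) with minView σ d
... | [] = refl
... | split L h R hL hR = rooted L (subst (λ t → isEmpty t ≡ false) (sym split≡) (join-nonempty h _ _))
                                   (trans (cong root split≡) (trans (root-join h _ _) (sym (minAbs-split hL hR))))
  where
  split≡ : toTree (suc f) (L ++ h ∷ R) ≡ join h (toTree f L) (toTree f R)
  split≡ = toTree-split hL hR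
  rooted : ∀ L {t} → isEmpty t ≡ false → root t ≡ minAbs (L ++ h ∷ R) → Rooted (L ++ h ∷ R) t
  rooted []      ne r = ne , r
  rooted (_ ∷ _) ne r = ne , r

endLetter : REnd → ℤ
endLetter (circ k) = + k
endLetter (star k) = - (+ k)
endLetter none     = + 0

rightEnd-node : ∀ {s} t → isEmpty t ≡ false → rightEnd (node m s t) ≡ rightEnd t
rightEnd-node (lf _)       _ = refl
rightEnd-node (node _ _ _) _ = refl

smaxStep-join : ∀ h L R a b → Rooted L a → Rooted R b →
  smaxStep h L R (endLetter (rightEnd a)) (endLetter (rightEnd b)) ≡ endLetter (rightEnd (join h a b))
smaxStep-join h [] [] _ _ refl refl with isPos h in pos
... | true  = sym (isPos⇒+∣i∣≡i pos)
... | false = sym (¬isPos⇒-∣i∣≡i pos)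
smaxStep-join h [] (_ ∷ _) _ b refl (eb , _) with isPos h in pos
... | true  rewrite eb = sym (isPos⇒+∣i∣≡i pos)
... | false rewrite eb = cong endLetter (sym (rightEnd-node b eb))
smaxStep-join h (_ ∷ _) [] a _ (ea , _) refl with isPos h in pos
... | true  rewrite ea = sym (isPos⇒+∣i∣≡i pos)
... | false rewrite ea = cong endLetter (sym (rightEnd-node a ea))
smaxStep-join h L@(_ ∷ _) R@(_ ∷ _) a b (ea , ra) (eb , rb) with isPos h
... | true  rewrite ea | eb | ra | rb with minAbs R <ᵇ minAbs L
...   | true  = cong endLetter (sym (rightEnd-node a ea))
...   | false = cong endLetter (sym (rightEnd-node b eb))
smaxStep-join h L@(_ ∷ _) R@(_ ∷ _) a b (ea , ra) (eb , rb) | false rewrite ea | eb | ra | rb with minAbs L <ᵇ minAbs R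
...   | true  = cong endLetter (sym (rightEnd-node a ea))
...   | false = cong endLetter (sym (rightEnd-node b eb))

smaxF-toTree : Fits f σ → smaxF f σ ≡ endLetter (rightEnd (toTree f σ))
smaxF-toTree {zero}  {[]} _ = refl
smaxF-toTree {suc f} {σ} (len , d) with minView σ d
... | [] = refl
... | split L h R hL hR with fits-split {L = L} (len , d)
...   | fitsL , fitsR = begin
  smaxF (suc f) (L ++ h ∷ R)                                              ≡⟨ smaxF-split hL hR ⟩
  smaxStep h L R (smaxF f L) (smaxF f R)                                  ≡⟨ cong₂ (smaxStep h L R) (smaxF-toTree fitsL) (smaxF-toTree fitsR) ⟩
  smaxStep h L R (endLetter (rightEnd a)) (endLetter (rightEnd b))        ≡⟨ smaxStep-join h L R a b (toTree-rooted fitsL) (toTree-rooted fitsR) ⟩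
  endLetter (rightEnd (join h a b))                                       ≡⟨ cong (endLetter ∘ rightEnd) (toTree-split hL hR) ⟨
  endLetter (rightEnd (toTree (suc f) (L ++ h ∷ R)))                      ∎
  where
  open ≡-Reasoning
  a b : Tree
  a = toTree f L
  b = toTree f R

word : Tree → List ℤ
word empty          = []
word (lf a)         = rootLetter (lf a) ∷ []
word t@(node _ l r) = word l ++ rootLetter t ∷ word r

∣rootLetter∣ : ∀ a l r → ∣ rootLetter (node a l r) ∣ ≡ a
∣rootLetter∣ a l r with positiveNode l r
... | true  = refl
... | false = ∣-i∣≡∣i∣ (+ a)

abs-word : ∀ t → map ∣_∣ (word t) ↭ labels t
abs-word empty        = ↭-refl
abs-word (lf a)       = ↭-reflexive (cong [_] (∣-i∣≡∣i∣ (+ a)))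
abs-word (node a l r) = begin
  map ∣_∣ (word l ++ s ∷ word r)                ≡⟨ map-++ ∣_∣ (word l) (s ∷ word r) ⟩
  map ∣_∣ (word l) ++ ∣ s ∣ ∷ map ∣_∣ (word r)  ↭⟨ shift ∣ s ∣ (map ∣_∣ (word l)) (map ∣_∣ (word r)) ⟩
  ∣ s ∣ ∷ map ∣_∣ (word l) ++ map ∣_∣ (word r)  ≡⟨ cong (_∷ _) (∣rootLetter∣ a l r) ⟩
  a ∷ map ∣_∣ (word l) ++ map ∣_∣ (word r)      ↭⟨ prep a (++⁺ (abs-word l) (abs-word r)) ⟩
  a ∷ labels l ++ labels r                      ∎
  where
  open PermutationReasoning
  s = rootLetter (node a l r)

Above⇒All< : ∀ t → Above m t → Increasing t → All (m <_) (labels t)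
Above⇒All< empty        _   _                   = []
Above⇒All< (lf _)       m<a _                   = m<a ∷ []
Above⇒All< (node a l r) m<a (al , ar , il , ir) =
  m<a ∷ All.++⁺ (All.map (<-trans m<a) (Above⇒All< l al il)) (All.map (<-trans m<a) (Above⇒All< r ar ir))

toTree-word : ∀ t → Increasing t → All (1 ≤_) (labels t) → length (word t) ≤ f → toTree f (word t) ≡ t
toTree-word {f} empty _ _ _ = toTree-[] f
toTree-word {suc f} (lf a) _ _ _ =
  trans (toTree-split {h = - (+ a)} {f = f} [] []) (trans (cong₂ (join (- (+ a))) (toTree-[] f) (toTree-[] f)) (join-leaf a))
toTree-word {zero} (node a l r) _ _ len with m+n≤o⇒n≤o (length (word l)) (subst (_≤ 0) (length-++ (word l)) len)
... | ()
toTree-word {suc f} (node (suc a) l r) (al , ar , il , ir) (_ ∷ pos) len with length-split {L = word l} len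
... | lenL , lenR = begin
  toTree (suc f) (word l ++ s ∷ word r)             ≡⟨ toTree-split (s≺word l al il) (s≺word r ar ir) ⟩
  join s (toTree f (word l)) (toTree f (word r))   ≡⟨ cong₂ (join s) (toTree-word l il (All.++⁻ˡ (labels l) pos) lenL)
                                                                       (toTree-word r ir (All.++⁻ʳ (labels l) pos) lenR) ⟩
  join s l r                                       ≡⟨ join-node a l r ⟩
  node (suc a) l r                                 ∎
  where
  open ≡-Reasoning
  s = rootLetter (node (suc a) l r)
  s≺word : ∀ t → Above (suc a) t → Increasing t → All (s ≺_) (word t)
  s≺word t above inc = All.map⁻ (All-resp-↭ (↭-sym (abs-word t))
    (subst (λ k → All (k <_) (labels t)) (sym (∣rootLetter∣ (suc a) l r)) (Above⇒All< t above inc)))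

length-oneTo : ∀ n → length (oneTo n) ≡ n
length-oneTo n = trans (length-map suc (upTo n)) (length-upTo n)

length-signedPerm : IsSignedPerm n σ → length σ ≡ n
length-signedPerm {n} {σ} p = trans (sym (length-map ∣_∣ σ)) (trans (↭-length p) (length-oneTo n))

signedPerm-fits : IsSignedPerm n σ → Fits n σ
signedPerm-fits {n} p =
  ≤-reflexive (length-signedPerm p) ,
  AllPairs.map⁻ (Unique-resp-↭ (↭⇒↭ₛ (↭-sym p)) (Unique.map⁺ suc-injective (Unique.upTo⁺ n)))

smax-toTree : IsSignedPerm n σ → smax σ ≡ endLetter (rightEnd (toTree n σ))
smax-toTree {n} {σ} p =
  subst (λ m → smaxF m σ ≡ endLetter (rightEnd (toTree n σ))) (sym (length-signedPerm p)) (smaxF-toTree (signedPerm-fits p))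

endLetter≡+⇔circ : ∀ {k} e → 1 ≤ k → (endLetter e ≡ + k) ⇔ (e ≡ circ k)
endLetter≡+⇔circ (circ _)       _       = mk⇔ (cong circ ∘ +-injective) (λ { refl → refl })
endLetter≡+⇔circ (star zero)    (s≤s _) = mk⇔ (λ ()) (λ ())
endLetter≡+⇔circ (star (suc _)) (s≤s _) = mk⇔ (λ ()) (λ ())
endLetter≡+⇔circ none           (s≤s _) = mk⇔ (λ ()) (λ ())

endLetter≡-⇔star : ∀ {k} e → 1 ≤ k → (endLetter e ≡ - (+ k)) ⇔ (e ≡ star k)
endLetter≡-⇔star (star _) _       = mk⇔ (cong star ∘ +-injective ∘ neg-injective) (λ { refl → refl })
endLetter≡-⇔star (circ _) (s≤s _) = mk⇔ (λ ()) (λ ())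
endLetter≡-⇔star none     (s≤s _) = mk⇔ (λ ()) (λ ())

theorem7p1 : (n : ℕ) → 1 ≤ n →
  Σ (SignedPerm n → Tree) λ φ →
    ((σ : SignedPerm n) → InT n (φ σ))
    × ((σ τ : SignedPerm n) → FlipEquiv σ τ → φ σ ≡ φ τ)
    × ((σ τ : SignedPerm n) → φ σ ≡ φ τ → FlipEquiv σ τ)
    × ((t : Tree) → InT n t → Σ (SignedPerm n) λ σ → φ σ ≡ t)
    × ((k : ℕ) → 1 ≤ k → k ≤ n → (σ : SignedPerm n) →
        ((smax (proj₁ σ) ≡ + k) ⇔ (rightEnd (φ σ) ≡ circ k))
        × ((smax (proj₁ σ) ≡ - (+ k)) ⇔ (rightEnd (φ σ) ≡ star k)))
theorem7p1 n _ = φ , valid , invariant , reflecting , onto , signedMaximum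
  where
  φ : SignedPerm n → Tree
  φ (σ , _) = toTree n σ

  valid : ∀ σ → InT n (φ σ)
  valid (σ , p) = ↭-trans (toTree-labels (signedPerm-fits p)) p , toTree-increasing (signedPerm-fits p)

  invariant : ∀ σ τ → FlipEquiv σ τ → φ σ ≡ φ τ
  invariant (σ , p) _ σ∼τ = toTree-∼ (signedPerm-fits p) (EqClosure.map flip⇒prefixFlip σ∼τ)

  reflecting : ∀ σ τ → φ σ ≡ φ τ → FlipEquiv σ τ
  reflecting (σ , p) (τ , q) e = EqClosure.map prefixFlip⇒flip (toTree-injective (signedPerm-fits p) (signedPerm-fits q) e)

  onto : ∀ t → InT n t → Σ (SignedPerm n) λ σ → φ σ ≡ t
  onto t (t↭ , inc) = (word t , word↭) , toTree-word t inc positive (≤-reflexive (length-signedPerm word↭))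
    where
    word↭ : IsSignedPerm n (word t)
    word↭ = ↭-trans (abs-word t) t↭
    positive : All (1 ≤_) (labels t)
    positive = All-resp-↭ (↭-sym t↭) (All.map⁺ (All.universal (λ _ → s≤s z≤n) (upTo n)))

  signedMaximum : ∀ k → 1 ≤ k → k ≤ n → ∀ σ →
    ((smax (proj₁ σ) ≡ + k) ⇔ (rightEnd (φ σ) ≡ circ k)) × ((smax (proj₁ σ) ≡ - (+ k)) ⇔ (rightEnd (φ σ) ≡ star k))
  signedMaximum k k≥1 _ (σ , p) rewrite smax-toTree p =
    endLetter≡+⇔circ (rightEnd (toTree n σ)) k≥1 , endLetter≡-⇔star (rightEnd (toTree n σ)) k≥1
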